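{- Let $(U_1,U_2,<)$ be an extended word equation. If $(A,B)$ is a cover and a boundary $(i,j)\in A$ cuts a boundary $(i',j')$, then $(i',j')\in B$.
   Context: Fix a set $\mathcal{X}$ of variables. A word equation is a pair $(U_1,U_2)$ of words over $\mathcal{X}$; write $U_1=U_{1,1}\cdots U_{1,m}$, $U_2=U_{2,1}\cdots U_{2,n}$ with $U_{i,j}\in\mathcal{X}$. Boundaries: $\{(1,j):1\le j\le m\}\cup\{(2,j):1\le j\le n\}$. A strict weak order is an irreflexive transitive relation $<$ with $a\approx b$ ($a\not<b$, $b\not<a$) an equivalence relation; $a\lesssim b$ means $a<b$ or $a\approx b$. A boundary order is a strict weak order on the boundaries with $(i,j)<(i,j+1)$ whenever both are boundaries and $(1,m)\approx(2,n)$; conventions $(1,0)\approx(2,0)$, $(i,0)<(i,1)$. An extended word equation $(U_1,U_2,<)$ is a word equation with a boundary order. For $k\ge j-1$ let $\langle i,[j,k]\rangle=\{(i,\ell):j\le\ell\le k\}$. A pair $(\langle i,[j,k]\rangle,\langle i',[j',k']\rangle)$ of such sets of boundaries is a cover if $i\neq i'$, $(i',j'-1)\lesssim(i,j-1)$ and $(i,k)\lesssim(i',k')$. Boundary $(i,j)$ cuts $(i',j')$ if $(i,j)\neq(i',j')$, $(i,j-1)<(i',j')$ and $(i',j'-1)<(i,j)$. -}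

module Defs where

open import Data.Nat using (ℕ; zero; suc; _≤_; _<_; pred)
open import Data.List using (List; length)
open import Data.Product using (_×_; _,_)
open import Data.Sum using (_⊎_)
open import Relation.Nullary using (¬_)
open import Relation.Binary.PropositionalEquality using (_≡_)
open import Level using (Level; _⊔_)

-- A position (i , j) with i ∈ {side₁, side₂} (the paper's 1 and 2).
-- Positions with j = 0 are the conventional "(i,0)" positions; positions with
-- 1 ≤ j ≤ |U_i| are the boundaries.
data Side : Set where
  side₁ side₂ : Side

Pos : Set
Pos = Side × ℕ

len : ∀ {a} {X : Set a} → List X → List X → Side → ℕ
len U₁ U₂ side₁ = length U₁
len U₁ U₂ side₂ = length U₂

module _ {a : Level} {X : Set a} (U₁ U₂ : List X) where

  IsBoundary : Pos → Set
  IsBoundary (i , j) = 1 ≤ j × j ≤ len U₁ U₂ i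

  IsPos : Pos → Set
  IsPos (i , j) = j ≤ len U₁ U₂ i

module _ {ℓ : Level} (_≺_ : Pos → Pos → Set ℓ) where

  _≈ₒ_ : Pos → Pos → Set ℓ
  x ≈ₒ y = ¬ (x ≺ y) × ¬ (y ≺ x)

  _≲_ : Pos → Pos → Set ℓ
  x ≲ y = (x ≺ y) ⊎ (x ≈ₒ y)

record IsBoundaryOrder {a ℓ : Level} {X : Set a} (U₁ U₂ : List X)
                       (_≺_ : Pos → Pos → Set ℓ) : Set (a ⊔ ℓ) where
  field
    irrefl : ∀ x → IsPos U₁ U₂ x → ¬ (x ≺ x)
    trans  : ∀ x y z → IsPos U₁ U₂ x → IsPos U₁ U₂ y → IsPos U₁ U₂ z →
             x ≺ y → y ≺ z → x ≺ z
    ≈-trans : ∀ x y z → IsPos U₁ U₂ x → IsPos U₁ U₂ y → IsPos U₁ U₂ z →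
              _≈ₒ_ _≺_ x y → _≈ₒ_ _≺_ y z → _≈ₒ_ _≺_ x z
    step   : ∀ i j → IsBoundary U₁ U₂ (i , j) → IsBoundary U₁ U₂ (i , suc j) →
             (i , j) ≺ (i , suc j)
    ends   : _≈ₒ_ _≺_ (side₁ , length U₁) (side₂ , length U₂)
    starts : _≈ₒ_ _≺_ (side₁ , 0) (side₂ , 0)
    first  : ∀ i → IsBoundary U₁ U₂ (i , 1) → (i , 0) ≺ (i , 1)

record ExtWordEq {a} (X : Set a) (ℓ : Level) : Set (a ⊔ Level.suc ℓ) where
  field
    U₁ U₂ : List X
    _≺_   : Pos → Pos → Set ℓ
    isBoundaryOrder : IsBoundaryOrder U₁ U₂ _≺_

-- The set ⟨ i , [ j , k ] ⟩ = { (i , l) : j ≤ l ≤ k } of boundaries,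
-- represented by its parameters; well-formed when 1 ≤ j, k ≥ j - 1, k ≤ |U_i|.
record Interval : Set where
  constructor ⟨_,[_,_]⟩
  field
    side : Side
    lo hi : ℕ

WellFormed : ∀ {a} {X : Set a} → List X → List X → Interval → Set
WellFormed U₁ U₂ ⟨ i ,[ j , k ]⟩ = 1 ≤ j × j ≤ suc k × k ≤ len U₁ U₂ i

_∈ᴵ_ : Pos → Interval → Set
(i' , l) ∈ᴵ ⟨ i ,[ j , k ]⟩ = i' ≡ i × j ≤ l × l ≤ k

module _ {ℓ : Level} (_≺_ : Pos → Pos → Set ℓ) where

  IsCover : Interval → Interval → Set ℓ
  IsCover ⟨ i ,[ j , k ]⟩ ⟨ i' ,[ j' , k' ]⟩ =
    ¬ (i ≡ i') × _≲_ _≺_ (i' , pred j') (i , pred j) × _≲_ _≺_ (i , k) (i' , k')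

  Cuts : Pos → Pos → Set ℓ
  Cuts (i , j) (i' , j') =
    ¬ ((i , j) ≡ (i' , j')) × ((i , pred j) ≺ (i' , j')) × ((i' , pred j') ≺ (i , j))

{-# OPTIONS --safe #-}
module Submission where

-- The relation "not below" of a strict weak order is transitive, and positions
-- on one side strictly increase.  If (i , l) ∈ A cuts (s , m), then
-- (i , l-1) ≺ (s , m) and (s , m-1) ≺ (i , l); on side i this contradicts
-- monotonicity, so s is the side i' of B.  If m < j', the chain
-- (i , l-1) ⊀ (i , j-1) ⊀ (i' , j'-1) ⊀ (i' , m), from monotonicity and the
-- cover condition, contradicts (i , l-1) ≺ (i' , m); symmetrically m ≤ k'.

open import Defs
open import Level using (Level)
open import Data.List using (List)
open import Data.Product using (_,_; proj₁)
open import Data.Sum using (inj₁; inj₂)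
open import Data.Nat using (ℕ; zero; suc; _≤_; _<_; pred; z≤n; s≤s)
open import Data.Nat.Properties
  using (≤-trans; <⇒≤; ≮⇒≥; <⇒≤pred; pred-mono-≤; pred[n]≤n; m≤n⇒m<n∨m≡n; m<1+n⇒m<n∨m≡n; <-cmp)
open import Relation.Nullary using (¬_; contradiction)
open import Relation.Binary using (tri<; tri≈; tri>)
open import Relation.Binary.PropositionalEquality using (_≡_; _≢_; refl)

two-sides : ∀ {i i' s : Side} → i ≢ i' → s ≢ i → s ≡ i'
two-sides {side₁} {side₁}          i≢i' _   = contradiction refl i≢i'
two-sides {side₂} {side₂}          i≢i' _   = contradiction refl i≢i'
two-sides {side₁} {side₂} {side₁} _    s≢i = contradiction refl s≢i
two-sides {side₂} {side₁} {side₂} _    s≢i = contradiction refl s≢i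
two-sides {side₁} {side₂} {side₂} _    _   = refl
two-sides {side₂} {side₁} {side₁} _    _   = refl

module BoundaryOrderProperties {a ℓ : Level} {X : Set a} {U₁ U₂ : List X}
         {_≺_ : Pos → Pos → Set ℓ} (isBoundaryOrder : IsBoundaryOrder U₁ U₂ _≺_) where

  open IsBoundaryOrder isBoundaryOrder

  L : Side → ℕ
  L = len U₁ U₂

  _⊀_ : Pos → Pos → Set ℓ
  x ⊀ y = ¬ (x ≺ y)

  ≺-asym : ∀ {x y} → IsPos U₁ U₂ x → IsPos U₁ U₂ y → x ≺ y → y ⊀ x
  ≺-asym px py x≺y y≺x = irrefl _ px (trans _ _ _ px py px x≺y y≺x)

  ≲⇒⊀ : ∀ {x y} → IsPos U₁ U₂ x → IsPos U₁ U₂ y → _≲_ _≺_ x y → y ⊀ x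
  ≲⇒⊀ px py (inj₁ x≺y)     = ≺-asym px py x≺y
  ≲⇒⊀ px py (inj₂ (_ , y⊀x)) = y⊀x

  -- In a strict weak order, "not below" is transitive: x ≺ z forces y to be
  -- comparable with x or with z, and otherwise x ≈ y ≈ z.
  ⊀-trans : ∀ {x y z} → IsPos U₁ U₂ x → IsPos U₁ U₂ y → IsPos U₁ U₂ z →
            x ⊀ y → y ⊀ z → x ⊀ z
  ⊀-trans {x} {y} {z} px py pz x⊀y y⊀z x≺z = proj₁ x≉z x≺z
    where
    x≉z = ≈-trans x y z px py pz
            (x⊀y , λ y≺x → y⊀z (trans _ _ _ py px pz y≺x x≺z))
            (y⊀z , λ z≺y → x⊀y (trans _ _ _ px pz py x≺z z≺y))

  ≺-suc : ∀ i c → suc c ≤ L i → (i , c) ≺ (i , suc c)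
  ≺-suc i zero    1≤L   = first i (s≤s z≤n , 1≤L)
  ≺-suc i (suc c) 2+c≤L = step i (suc c) (s≤s z≤n , <⇒≤ 2+c≤L) (s≤s z≤n , 2+c≤L)

  <⇒≺ : ∀ i {m n} → m < n → n ≤ L i → (i , m) ≺ (i , n)
  <⇒≺ i {m} {suc n} m<1+n 1+n≤L with m<1+n⇒m<n∨m≡n m<1+n
  ... | inj₂ refl = ≺-suc i m 1+n≤L
  ... | inj₁ m<n  = trans _ _ _ (≤-trans (<⇒≤ m<n) (<⇒≤ 1+n≤L)) (<⇒≤ 1+n≤L) 1+n≤L
                      (<⇒≺ i m<n (<⇒≤ 1+n≤L)) (≺-suc i n 1+n≤L)

  ≤⇒⊀ : ∀ i {m n} → m ≤ n → n ≤ L i → (i , n) ⊀ (i , m)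
  ≤⇒⊀ i {m} m≤n n≤L with m≤n⇒m<n∨m≡n m≤n
  ... | inj₂ refl = irrefl (i , m) n≤L
  ... | inj₁ m<n  = ≺-asym (≤-trans m≤n n≤L) n≤L (<⇒≺ i m<n n≤L)

  cut-changes-side : ∀ {i s l m} → l ≤ L i → m ≤ L s → Cuts _≺_ (i , l) (s , m) → s ≢ i
  cut-changes-side {i} {_} {l} {m} l≤L m≤L (p≢q , below , above) refl with <-cmp m l
  ... | tri< m<l _ _ = ≤⇒⊀ i (<⇒≤pred m<l) (≤-trans pred[n]≤n l≤L) below
  ... | tri≈ _ refl _ = p≢q refl
  ... | tri> _ _ l<m = ≤⇒⊀ i (<⇒≤pred l<m) (≤-trans pred[n]≤n m≤L) above

  cover-lo≤cut : ∀ {i i' j j' l m} → j ≤ l → l ≤ L i → pred j' ≤ L i' → m ≤ L i' →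
                 _≲_ _≺_ (i' , pred j') (i , pred j) → (i , pred l) ≺ (i' , m) → j' ≤ m
  cover-lo≤cut {i} {i'} j≤l l≤L pj'≤L m≤L lo'≲lo below = ≮⇒≥ λ m<j' →
    ⊀-trans pl≤L pj'≤L m≤L
      (⊀-trans pl≤L pj≤L pj'≤L (≤⇒⊀ i (pred-mono-≤ j≤l) pl≤L) (≲⇒⊀ pj'≤L pj≤L lo'≲lo))
      (≤⇒⊀ i' (<⇒≤pred m<j') pj'≤L)
      below
    where
    pl≤L = ≤-trans pred[n]≤n l≤L
    pj≤L = ≤-trans (pred-mono-≤ j≤l) pl≤L

  cut≤cover-hi : ∀ {i i' k k' l m} → l ≤ k → k ≤ L i → k' ≤ L i' → m ≤ L i' →
                 _≲_ _≺_ (i , k) (i' , k') → (i' , pred m) ≺ (i , l) → m ≤ k'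
  cut≤cover-hi {i} {i'} l≤k k≤L k'≤L m≤L hi≲hi' above = ≮⇒≥ λ k'<m →
    ⊀-trans pm≤L k'≤L l≤L
      (≤⇒⊀ i' (<⇒≤pred k'<m) pm≤L)
      (⊀-trans k'≤L k≤L l≤L (≲⇒⊀ k≤L k'≤L hi≲hi') (≤⇒⊀ i l≤k k≤L))
      above
    where
    pm≤L = ≤-trans pred[n]≤n m≤L
    l≤L = ≤-trans l≤k k≤L

lemma22 : ∀ {a ℓ : Level} {X : Set a} (E : ExtWordEq X ℓ) →
    let open ExtWordEq E in
    (A B : Interval) → WellFormed U₁ U₂ A → WellFormed U₁ U₂ B →
    IsCover _≺_ A B →
    (p q : Pos) → p ∈ᴵ A → IsBoundary U₁ U₂ q → Cuts _≺_ p q →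
    q ∈ᴵ B
lemma22 E ⟨ i ,[ j , k ]⟩ ⟨ i' ,[ j' , k' ]⟩ (_ , _ , k≤L) (_ , j'≤1+k' , k'≤L)
        (i≢i' , lo'≲lo , hi≲hi') (.i , l) (s , m) (refl , j≤l , l≤k) (_ , m≤L)
        cut@(_ , below , above) =
  on-side-i' (two-sides i≢i' (cut-changes-side (≤-trans l≤k k≤L) m≤L cut))
  where
  open BoundaryOrderProperties (ExtWordEq.isBoundaryOrder E)
  on-side-i' : s ≡ i' → (s , m) ∈ᴵ ⟨ i' ,[ j' , k' ]⟩
  on-side-i' refl =
      refl
    , cover-lo≤cut j≤l (≤-trans l≤k k≤L) (≤-trans (pred-mono-≤ j'≤1+k') k'≤L) m≤L lo'≲lo below
    , cut≤cover-hi l≤k k≤L k'≤L m≤L hi≲hi' above
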